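{- Let $G$ and $H$ be nontrivial graphs, let $v\in V(H)$ be a root, and let $f$ be a Roman dominating function on $G\circ_v H$ of weight $\gamma_R(G\circ_v H)$. Let $\mathcal{B}_f=\{x\in V(G): \omega(f_x)=\gamma_R(H)-1\}$. If $\mathcal{B}_f\neq\emptyset$, then (i) $\gamma_R(H-v)=\gamma_R(H)-1$, and (ii) $\gamma_R(G\circ_v H)\leq \gamma_R(G)+n(G)(\gamma_R(H)-1)$.
   Context: All graphs are finite and simple; a graph is nontrivial if it has at least two vertices; $n(G)=|V(G)|$. For a nontrivial graph $G$ and a nontrivial graph $H$ with a root $v\in V(H)$, the rooted product graph $G\circ_v H$ is obtained by taking one copy of $G$ and $n(G)$ copies of $H$, and identifying the $i$-th vertex of $G$ with the vertex $v$ in the $i$-th copy of $H$, for each $i$. For $x\in V(G)$, $H_x$ denotes the copy of $H$ containing $x$, and for a function $f$ on $V(G\circ_v H)$, $f_x$ denotes its restriction to $V(H_x)$, with weight $\omega(f_x)=\sum_{u\in V(H_x)}f(u)$. A Roman dominating function (RDF) on a graph $X$ is $f:V(X)\to\{0,1,2\}$ such that every vertex with value $0$ has a neighbor with value $2$; $\gamma_R(X)$ is the minimum of $\sum_u f(u)$ over RDFs $f$ on $X$. $H-v$ is the graph obtained from $H$ by deleting $v$. -}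

module Defs where

open import Data.Nat using (ℕ; zero; suc; _+_; _*_; _≤_)
open import Data.Fin using (Fin; punchIn; combine; remQuot)
open import Data.Product using (Σ; _×_; _,_; proj₁; proj₂; ∃)
open import Data.Sum using (_⊎_)
open import Relation.Binary.PropositionalEquality using (_≡_; _≢_)
open import Relation.Nullary using (¬_)

record Graph : Set₁ where
  field
    n     : ℕ
    Adj   : Fin n → Fin n → Set
    sym   : ∀ {x y} → Adj x y → Adj y x
    irrefl : ∀ {x} → ¬ Adj x x
open Graph public

Nontrivial : Graph → Set
Nontrivial G = 2 ≤ n G

sumFin : (k : ℕ) → (Fin k → ℕ) → ℕ
sumFin zero    f = 0
sumFin (suc k) f = f Fin.zero + sumFin k (λ i → f (Fin.suc i))

weight : (G : Graph) → (Fin (n G) → ℕ) → ℕ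
weight G f = sumFin (n G) f

IsRDF : (G : Graph) → (Fin (n G) → ℕ) → Set
IsRDF G f = (∀ u → f u ≤ 2)
          × (∀ u → f u ≡ 0 → ∃ λ w → Adj G u w × f w ≡ 2)

IsγR : Graph → ℕ → Set
IsγR G k = (∃ λ f → IsRDF G f × weight G f ≡ k)
         × (∀ g → IsRDF G g → k ≤ weight G g)

-- Rooted product G ∘_v H.  Vertex set Fin (n G * n H) ≅ Fin (n G) × Fin (n H):
-- the pair (x , h) is vertex h of the copy H_x, and (x , v) is identified with x ∈ V(G).
RPAdj : (G H : Graph) → Fin (n H) → Fin (n G) × Fin (n H) → Fin (n G) × Fin (n H) → Set
RPAdj G H v (x , a) (y , b) = (x ≡ y × Adj H a b) ⊎ (a ≡ v × b ≡ v × Adj G x y)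

RPAdj-sym : ∀ G H v {p q} → RPAdj G H v p q → RPAdj G H v q p
RPAdj-sym G H v (Data.Sum.inj₁ (_≡_.refl , a)) = Data.Sum.inj₁ (_≡_.refl , sym H a)
RPAdj-sym G H v (Data.Sum.inj₂ (_≡_.refl , _≡_.refl , a)) = Data.Sum.inj₂ (_≡_.refl , _≡_.refl , sym G a)

RPAdj-irrefl : ∀ G H v {p} → ¬ RPAdj G H v p p
RPAdj-irrefl G H v (Data.Sum.inj₁ (_ , a)) = irrefl H a
RPAdj-irrefl G H v (Data.Sum.inj₂ (_ , _ , a)) = irrefl G a

rootedProduct : (G H : Graph) → Fin (n H) → Graph
rootedProduct G H v = record
  { n = n G * n H
  ; Adj = λ i j → RPAdj G H v (remQuot (n H) i) (remQuot (n H) j)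
  ; sym = RPAdj-sym G H v
  ; irrefl = RPAdj-irrefl G H v
  }

vtx : (G H : Graph) → Fin (n G) → Fin (n H) → Fin (n G * n H)
vtx G H x h = combine x h

ωAt : (G H : Graph) → (Fin (n G * n H) → ℕ) → Fin (n G) → ℕ
ωAt G H f x = sumFin (n H) (λ h → f (vtx G H x h))

deleteVertex' : (k : ℕ) (A : Fin (suc k) → Fin (suc k) → Set)
  → (∀ {x y} → A x y → A y x) → (∀ {x} → ¬ A x x) → Fin (suc k) → Graph
deleteVertex' k A s ir v = record
  { n = k ; Adj = λ i j → A (punchIn v i) (punchIn v j) ; sym = s ; irrefl = ir }

deleteVertex : (H : Graph) → Fin (n H) → Graph
deleteVertex record { n = zero } ()
deleteVertex record { n = suc k ; Adj = A ; sym = s ; irrefl = ir } v = deleteVertex' k A s ir v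

-- Inside a copy H_x, a Roman dominating function f of G ∘ᵥ H dominates every vertex except
-- possibly the root x.  If ω(f_x) = γR(H) − 1, then f_x is not a Roman dominating function of H,
-- so f(x) = 0; then x dominates nothing in H_x, and f_x on H_x − x is a Roman dominating
-- function of H − v, giving γR(H − v) ≤ γR(H) − 1.  Conversely, extending a minimum Roman
-- dominating function of H − v by the value 1 at v gives γR(H) ≤ γR(H − v) + 1.  For (ii),
-- put a minimum Roman dominating function of G on the roots and a minimum one of H − v on the
-- rest of every copy; a root of value 0 is then dominated in G.
module Submission where

open import Defs hiding (sym)
open import Data.Nat using (ℕ; zero; suc; _+_; _*_; _∸_; _≤_; _<_; _≟_; z≤n; s≤s)
open import Data.Nat.Properties
  using (+-0-commutativeMonoid; +-assoc; m≤m+n; m≤n+m; ≤-trans; ≤-antisym; <⇒≱; n≢0⇒n>0;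
         ∸-monoˡ-≤; ∸-monoʳ-<; 1+n≢0; module ≤-Reasoning)
open import Data.Fin as Fin using (Fin; zero; suc; punchIn; punchOut; combine; remQuot; _↑ˡ_; _↑ʳ_)
open import Data.Fin.Properties using (remQuot-combine; combine-remQuot; punchInᵢ≢i; punchIn-punchOut)
open import Data.Vec.Functional using (Vector; insertAt)
open import Data.Vec.Functional.Properties using (insertAt-lookup; insertAt-punchIn)
open import Data.Product using (_×_; ∃; ∃₂; _,_; proj₁; proj₂; uncurry)
open import Data.Sum using (_⊎_; inj₁; inj₂)
open import Function using (_∘_)
open import Relation.Nullary using (yes; no; contradiction)
open import Relation.Binary.PropositionalEquality
  using (_≡_; _≢_; _≗_; refl; sym; trans; cong; cong₂; subst; subst₂; module ≡-Reasoning)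
open import Algebra.Properties.CommutativeMonoid.Sum +-0-commutativeMonoid
  using (sum; sum-cong-≗; sum-remove; ∑-distrib-+)

sumFin≡sum : ∀ k (f : Fin k → ℕ) → sumFin k f ≡ sum f
sumFin≡sum zero    f = refl
sumFin≡sum (suc k) f = cong (f zero +_) (sumFin≡sum k (f ∘ suc))

sum-const : ∀ n c → sum {n} (λ _ → c) ≡ n * c
sum-const zero    c = refl
sum-const (suc n) c = cong (c +_) (sum-const n c)

sum-++ : ∀ m n (f : Vector ℕ (m + n)) → sum f ≡ sum (f ∘ (_↑ˡ n)) + sum (f ∘ (m ↑ʳ_))
sum-++ zero    n f = refl
sum-++ (suc m) n f = trans (cong (f zero +_) (sum-++ m n (f ∘ suc))) (sym (+-assoc (f zero) _ _))

sum-combine : ∀ m n (f : Vector ℕ (m * n))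
  → sum f ≡ sum (λ (x : Fin m) → sum (λ (h : Fin n) → f (combine x h)))
sum-combine zero    n f = refl
sum-combine (suc m) n f =
  trans (sum-++ n (m * n) f)
        (cong (sum (λ (h : Fin n) → f (h ↑ˡ m * n)) +_) (sum-combine m n (f ∘ (n ↑ʳ_))))

lookup≤sum : ∀ {n} (f : Vector ℕ n) i → f i ≤ sum f
lookup≤sum f zero    = m≤m+n _ _
lookup≤sum f (suc i) = ≤-trans (lookup≤sum (f ∘ suc) i) (m≤n+m _ _)

module _ (G : Graph) where

  weight≡sum : ∀ f → weight G f ≡ sum f
  weight≡sum = sumFin≡sum (n G)

  weight-cong : ∀ {f g} → f ≗ g → weight G f ≡ weight G g
  weight-cong {f} {g} f≗g = begin
    weight G f ≡⟨ weight≡sum f ⟩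
    sum f      ≡⟨ sum-cong-≗ f≗g ⟩
    sum g      ≡⟨ weight≡sum g ⟨
    weight G g ∎
    where open ≡-Reasoning

  weight-+-const : ∀ f c → weight G (λ x → f x + c) ≡ weight G f + n G * c
  weight-+-const f c = begin
    weight G (λ x → f x + c)      ≡⟨ weight≡sum _ ⟩
    sum (λ x → f x + c)           ≡⟨ ∑-distrib-+ f (λ _ → c) ⟩
    sum f + sum {n G} (λ _ → c)   ≡⟨ cong₂ _+_ (sym (weight≡sum f)) (sum-const (n G) c) ⟩
    weight G f + n G * c          ∎
    where open ≡-Reasoning

  IsRDF⇒positive-vertex : ∀ {f} → IsRDF G f → Fin (n G) → ∃ λ w → 1 ≤ f w
  IsRDF⇒positive-vertex {f} (_ , dominated) u with f u ≟ 0
  ... | no  fu≢0 = u , n≢0⇒n>0 fu≢0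
  ... | yes fu≡0 = let (w , _ , fw≡2) = dominated u fu≡0 in w , subst (1 ≤_) (sym fw≡2) (s≤s z≤n)

  IsRDF⇒weight-positive : ∀ {f} → IsRDF G f → Fin (n G) → 1 ≤ weight G f
  IsRDF⇒weight-positive {f} f-rdf u =
    let (w , 1≤fw) = IsRDF⇒positive-vertex f-rdf u
    in subst (1 ≤_) (sym (weight≡sum f)) (≤-trans 1≤fw (lookup≤sum f w))

  γR-positive : ∀ {γ} → IsγR G γ → Fin (n G) → 1 ≤ γ
  γR-positive ((f , f-rdf , f-weight) , _) u = subst (1 ≤_) f-weight (IsRDF⇒weight-positive f-rdf u)

embed : (H : Graph) (v : Fin (n H)) → Fin (n (deleteVertex H v)) → Fin (n H)
embed record { n = suc _ } v = punchIn v

embed≢root : (H : Graph) (v : Fin (n H)) (i : Fin (n (deleteVertex H v))) → embed H v i ≢ v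
embed≢root record { n = suc _ } v = punchInᵢ≢i v

root-or-embed : (H : Graph) (v u : Fin (n H)) → u ≡ v ⊎ ∃ λ i → embed H v i ≡ u
root-or-embed record { n = suc _ } v u with v Fin.≟ u
... | yes v≡u = inj₁ (sym v≡u)
... | no  v≢u = inj₂ (punchOut v≢u , punchIn-punchOut v≢u)

embed-Adj : (H : Graph) (v : Fin (n H)) {i j : Fin (n (deleteVertex H v))}
  → Adj (deleteVertex H v) i j → Adj H (embed H v i) (embed H v j)
embed-Adj record { n = suc _ } v adj = adj

embed-Adj⁻ : (H : Graph) (v : Fin (n H)) {i j : Fin (n (deleteVertex H v))}
  → Adj H (embed H v i) (embed H v j) → Adj (deleteVertex H v) i j
embed-Adj⁻ record { n = suc _ } v adj = adj

weight-deleteVertex : (H : Graph) (v : Fin (n H)) (f : Fin (n H) → ℕ)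
  → weight H f ≡ f v + weight (deleteVertex H v) (f ∘ embed H v)
weight-deleteVertex H@record { n = suc k } v f = begin
  weight H f                         ≡⟨ sumFin≡sum (suc k) f ⟩
  sum f                              ≡⟨ sum-remove {i = v} f ⟩
  f v + sum (f ∘ punchIn v)          ≡⟨ cong (f v +_) (sumFin≡sum k (f ∘ punchIn v)) ⟨
  f v + sumFin k (f ∘ punchIn v)     ∎
  where open ≡-Reasoning

insertRoot : (H : Graph) (v : Fin (n H)) → ℕ → (Fin (n (deleteVertex H v)) → ℕ) → Fin (n H) → ℕ
insertRoot record { n = suc _ } v c g = insertAt g v c

insertRoot-root : (H : Graph) (v : Fin (n H)) → ∀ c g → insertRoot H v c g v ≡ c
insertRoot-root record { n = suc _ } v c g = insertAt-lookup g v c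

insertRoot-embed : (H : Graph) (v : Fin (n H)) → ∀ c g i → insertRoot H v c g (embed H v i) ≡ g i
insertRoot-embed record { n = suc _ } v c g = insertAt-punchIn g v c

weight-insertRoot : (H : Graph) (v : Fin (n H)) → ∀ c g
  → weight H (insertRoot H v c g) ≡ c + weight (deleteVertex H v) g
weight-insertRoot H v c g = begin
  weight H f                                         ≡⟨ weight-deleteVertex H v f ⟩
  f v + weight (deleteVertex H v) (f ∘ embed H v)    ≡⟨ cong₂ _+_ (insertRoot-root H v c g)
                                                          (weight-cong (deleteVertex H v) (insertRoot-embed H v c g)) ⟩
  c + weight (deleteVertex H v) g                    ∎
  where
  open ≡-Reasoning
  f = insertRoot H v c g

IsRDFAwayFrom : (H : Graph) → Fin (n H) → (Fin (n H) → ℕ) → Set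
IsRDFAwayFrom H v f = (∀ u → f u ≤ 2) × (∀ u → u ≢ v → f u ≡ 0 → ∃ λ w → Adj H u w × f w ≡ 2)

module _ (H : Graph) (v : Fin (n H)) where

  IsRDFAwayFrom⇒IsRDF : ∀ {f} → IsRDFAwayFrom H v f → f v ≢ 0 → IsRDF H f
  IsRDFAwayFrom⇒IsRDF (bounded , dominated) fv≢0 =
    bounded , λ u fu≡0 → dominated u (λ { refl → fv≢0 fu≡0 }) fu≡0

  IsRDFAwayFrom⇒IsRDF-deleteVertex : ∀ {f} → IsRDFAwayFrom H v f → f v ≡ 0
    → IsRDF (deleteVertex H v) (f ∘ embed H v)
  IsRDFAwayFrom⇒IsRDF-deleteVertex {f} (bounded , dominated) fv≡0 = bounded ∘ embed H v , dominated′
    where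
    dominated′ : ∀ i → f (embed H v i) ≡ 0 → ∃ λ j → Adj (deleteVertex H v) i j × f (embed H v j) ≡ 2
    dominated′ i fi≡0 with dominated (embed H v i) (embed≢root H v i) fi≡0
    ... | w , adj , fw≡2 with root-or-embed H v w
    ...   | inj₁ refl       = contradiction (trans (sym fw≡2) fv≡0) λ ()
    ...   | inj₂ (j , refl) = j , embed-Adj⁻ H v adj , fw≡2

  insertRoot-IsRDFAwayFrom : ∀ {c g} → c ≤ 2 → IsRDF (deleteVertex H v) g
    → IsRDFAwayFrom H v (insertRoot H v c g)
  insertRoot-IsRDFAwayFrom {c} {g} c≤2 (bounded , dominated) = bounded′ , dominated′
    where
    bounded′ : ∀ u → insertRoot H v c g u ≤ 2
    bounded′ u with root-or-embed H v u
    ... | inj₁ refl       = subst (_≤ 2) (sym (insertRoot-root H v c g)) c≤2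
    ... | inj₂ (i , refl) = subst (_≤ 2) (sym (insertRoot-embed H v c g i)) (bounded i)

    dominated′ : ∀ u → u ≢ v → insertRoot H v c g u ≡ 0
      → ∃ λ w → Adj H u w × insertRoot H v c g w ≡ 2
    dominated′ u u≢v with root-or-embed H v u
    ... | inj₁ u≡v       = contradiction u≡v u≢v
    ... | inj₂ (i , refl) = λ gi≡0 →
      let (j , adj , gj≡2) = dominated i (trans (sym (insertRoot-embed H v c g i)) gi≡0)
      in embed H v j , embed-Adj H v adj , trans (insertRoot-embed H v c g j) gj≡2

  γR≤suc-γR-deleteVertex : ∀ {γH γHv} → IsγR H γH → IsγR (deleteVertex H v) γHv → γH ≤ suc γHv
  γR≤suc-γR-deleteVertex {γH} (_ , γH-min) ((g , g-rdf , g-weight) , _) =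
    subst (γH ≤_) (trans (weight-insertRoot H v 1 g) (cong suc g-weight)) (γH-min f f-rdf)
    where
    f = insertRoot H v 1 g
    f-rdf : IsRDF H f
    f-rdf = IsRDFAwayFrom⇒IsRDF (insertRoot-IsRDFAwayFrom (s≤s z≤n) g-rdf)
              (λ fv≡0 → 1+n≢0 (trans (sym (insertRoot-root H v 1 g)) fv≡0))

  γR-deleteVertex≤ : ∀ {γH γHv f} → IsγR H γH → IsγR (deleteVertex H v) γHv
    → IsRDFAwayFrom H v f → weight H f < γH → γHv ≤ weight H f
  γR-deleteVertex≤ {γHv = γHv} {f} (_ , γH-min) (_ , γHv-min) f-away f<γH with f v ≟ 0
  ... | no  fv≢0 = contradiction (γH-min f (IsRDFAwayFrom⇒IsRDF f-away fv≢0)) (<⇒≱ f<γH)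
  ... | yes fv≡0 = begin
    γHv                 ≤⟨ γHv-min _ (IsRDFAwayFrom⇒IsRDF-deleteVertex f-away fv≡0) ⟩
    weight H-v f′       ≡⟨ cong (_+ weight H-v f′) fv≡0 ⟨
    f v + weight H-v f′ ≡⟨ weight-deleteVertex H v f ⟨
    weight H f          ∎
    where
    open ≤-Reasoning
    H-v = deleteVertex H v
    f′ = f ∘ embed H v

  γR-deleteVertex≡pred-γR : ∀ {γH γHv f} → IsγR H γH → IsγR (deleteVertex H v) γHv
    → IsRDFAwayFrom H v f → weight H f ≡ γH ∸ 1 → γHv ≡ γH ∸ 1
  γR-deleteVertex≡pred-γR {γH} {γHv} γH-opt γHv-opt f-away f-weight = ≤-antisym upper lower
    where
    f<γH = subst (_< γH) (sym f-weight) (∸-monoʳ-< {γH} {1} {0} (s≤s z≤n) (γR-positive H γH-opt v))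
    upper = subst (γHv ≤_) f-weight (γR-deleteVertex≤ γH-opt γHv-opt f-away f<γH)
    lower = ∸-monoˡ-≤ 1 (γR≤suc-γR-deleteVertex γH-opt γHv-opt)

module _ (G H : Graph) (v : Fin (n H)) where

  private
    P = rootedProduct G H v
    V = Fin (n G * n H)

  fiber : (V → ℕ) → Fin (n G) → Fin (n H) → ℕ
  fiber f x h = f (vtx G H x h)

  fromFibers : (Fin (n G) → Fin (n H) → ℕ) → V → ℕ
  fromFibers F = uncurry F ∘ remQuot (n H)

  fiber-fromFibers : ∀ F x → fiber (fromFibers F) x ≗ F x
  fiber-fromFibers F x h = cong (uncurry F) (remQuot-combine x h)

  vtx-elim : (Q : V → Set) → (∀ x h → Q (vtx G H x h)) → ∀ p → Q p
  vtx-elim Q q p = subst Q (combine-remQuot {n G} (n H) p) (q _ _)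

  vtx-Adj : ∀ {x a y b} → RPAdj G H v (x , a) (y , b) → Adj P (vtx G H x a) (vtx G H y b)
  vtx-Adj {x} {a} {y} {b} = subst₂ (RPAdj G H v) (sym (remQuot-combine x a)) (sym (remQuot-combine y b))

  vtx-Adj⁻ : ∀ {x a y b} → Adj P (vtx G H x a) (vtx G H y b) → RPAdj G H v (x , a) (y , b)
  vtx-Adj⁻ {x} {a} {y} {b} = subst₂ (RPAdj G H v) (remQuot-combine x a) (remQuot-combine y b)

  weight-rootedProduct : ∀ f → weight P f ≡ weight G (ωAt G H f)
  weight-rootedProduct f = begin
    weight P f                                    ≡⟨ sumFin≡sum (n G * n H) f ⟩
    sum f                                         ≡⟨ sum-combine (n G) (n H) f ⟩
    sum (λ x → sum (fiber f x))                   ≡⟨ sum-cong-≗ (λ x → weight≡sum H (fiber f x)) ⟨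
    sum (ωAt G H f)                               ≡⟨ weight≡sum G (ωAt G H f) ⟨
    weight G (ωAt G H f)                          ∎
    where open ≡-Reasoning

  weight-fromFibers : ∀ F → weight P (fromFibers F) ≡ weight G (λ x → weight H (F x))
  weight-fromFibers F =
    trans (weight-rootedProduct (fromFibers F)) (weight-cong G (λ x → weight-cong H (fiber-fromFibers F x)))

  IsRDF⇒dominator : ∀ {f} → IsRDF P f → ∀ x a → fiber f x a ≡ 0
    → ∃₂ λ y b → RPAdj G H v (x , a) (y , b) × fiber f y b ≡ 2
  IsRDF⇒dominator {f} (_ , dominated) x a fxa≡0 =
    let (q , adj , fq≡2) = dominated (vtx G H x a) fxa≡0
    in vtx-elim (λ q → Adj P (vtx G H x a) q → f q ≡ 2
                        → ∃₂ λ y b → RPAdj G H v (x , a) (y , b) × fiber f y b ≡ 2)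
                (λ y b adj′ fyb≡2 → y , b , vtx-Adj⁻ adj′ , fyb≡2) q adj fq≡2

  fiber-IsRDFAwayFrom : ∀ {f} → IsRDF P f → ∀ x → IsRDFAwayFrom H v (fiber f x)
  fiber-IsRDFAwayFrom {f} f-rdf x = (λ h → proj₁ f-rdf (vtx G H x h)) , dominated
    where
    dominated : ∀ a → a ≢ v → fiber f x a ≡ 0 → ∃ λ b → Adj H a b × fiber f x b ≡ 2
    dominated a a≢v fxa≡0 with IsRDF⇒dominator f-rdf x a fxa≡0
    ... | _ , b , inj₁ (refl , adj) , fxb≡2 = b , adj , fxb≡2
    ... | _ , _ , inj₂ (a≡v , _)    , _     = contradiction a≡v a≢v

  fromFibers-IsRDF : ∀ {F} → (∀ x → IsRDFAwayFrom H v (F x))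
    → (∀ x → F x v ≡ 0 → ∃ λ y → Adj G x y × F y v ≡ 2) → IsRDF P (fromFibers F)
  fromFibers-IsRDF {F} away root-dominated =
    vtx-elim (λ p → fromFibers F p ≤ 2) bounded ,
    vtx-elim (λ p → fromFibers F p ≡ 0 → ∃ λ q → Adj P p q × fromFibers F q ≡ 2)
      (λ x h → dominated x h ∘ trans (sym (fiber-fromFibers F x h)))
    where
    bounded : ∀ x h → fromFibers F (vtx G H x h) ≤ 2
    bounded x h = subst (_≤ 2) (sym (fiber-fromFibers F x h)) (proj₁ (away x) h)

    reach : ∀ {x a y b} → RPAdj G H v (x , a) (y , b) → F y b ≡ 2
      → ∃ λ q → Adj P (vtx G H x a) q × fromFibers F q ≡ 2
    reach {y = y} {b} adj Fyb≡2 = vtx G H y b , vtx-Adj adj , trans (fiber-fromFibers F y b) Fyb≡2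

    dominated : ∀ x h → F x h ≡ 0 → ∃ λ q → Adj P (vtx G H x h) q × fromFibers F q ≡ 2
    dominated x h Fxh≡0 with h Fin.≟ v
    ... | yes refl = let (y , adj , Fyv≡2) = root-dominated x Fxh≡0 in reach (inj₂ (refl , refl , adj)) Fyv≡2
    ... | no  h≢v  = let (b , adj , Fxb≡2) = proj₂ (away x) h h≢v Fxh≡0 in reach (inj₁ (refl , adj)) Fxb≡2

  γR-rootedProduct≤ : ∀ {γGH γG γHv} → IsγR P γGH → IsγR G γG → IsγR (deleteVertex H v) γHv
    → γGH ≤ γG + n G * γHv
  γR-rootedProduct≤ {γGH} {γG} {γHv} (_ , γGH-min) ((g , (g-bounded , g-dominated) , g-weight) , _)
                    ((r , r-rdf , r-weight) , _) =
    subst (γGH ≤_) F-weight (γGH-min (fromFibers F) (fromFibers-IsRDF away root-dominated))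
    where
    F : Fin (n G) → Fin (n H) → ℕ
    F x = insertRoot H v (g x) r

    away : ∀ x → IsRDFAwayFrom H v (F x)
    away x = insertRoot-IsRDFAwayFrom H v (g-bounded x) r-rdf

    root-dominated : ∀ x → F x v ≡ 0 → ∃ λ y → Adj G x y × F y v ≡ 2
    root-dominated x Fxv≡0 =
      let (y , adj , gy≡2) = g-dominated x (trans (sym (insertRoot-root H v (g x) r)) Fxv≡0)
      in y , adj , trans (insertRoot-root H v (g y) r) gy≡2

    F-weight : weight P (fromFibers F) ≡ γG + n G * γHv
    F-weight = begin
      weight P (fromFibers F)                            ≡⟨ weight-fromFibers F ⟩
      weight G (λ x → weight H (F x))                    ≡⟨ weight-cong G (λ x → weight-insertRoot H v (g x) r) ⟩
      weight G (λ x → g x + weight (deleteVertex H v) r) ≡⟨ weight-+-const G g _ ⟩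
      weight G g + n G * weight (deleteVertex H v) r     ≡⟨ cong₂ (λ a b → a + n G * b) g-weight r-weight ⟩
      γG + n G * γHv                                     ∎
      where open ≡-Reasoning

lemma3p4 : (G H : Graph) → Nontrivial G → Nontrivial H → (v : Fin (n H))
    → (γGH γG γH γHv : ℕ)
    → IsγR (rootedProduct G H v) γGH → IsγR G γG → IsγR H γH → IsγR (deleteVertex H v) γHv
    → (f : Fin (n G * n H) → ℕ) → IsRDF (rootedProduct G H v) f
    → weight (rootedProduct G H v) f ≡ γGH
    → (∃ λ x → ωAt G H f x ≡ γH ∸ 1)
    → (γHv ≡ γH ∸ 1) × (γGH ≤ γG + n G * (γH ∸ 1))
lemma3p4 G H _ _ v γGH γG γH γHv γGH-opt γG-opt γH-opt γHv-opt f f-rdf _ (x , ωx≡) = part-i , part-ii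
  where
  part-i : γHv ≡ γH ∸ 1
  part-i = γR-deleteVertex≡pred-γR H v γH-opt γHv-opt (fiber-IsRDFAwayFrom G H v f-rdf x) ωx≡

  part-ii : γGH ≤ γG + n G * (γH ∸ 1)
  part-ii = subst (λ t → γGH ≤ γG + n G * t) part-i (γR-rootedProduct≤ G H v γGH-opt γG-opt γHv-opt)
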